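{- Johnstone's dcpo $\mathcal{S}$ is dominated.
   Context: Let $\overline{\mathbb{N}}=\mathbb{N}\cup\{\infty\}$. Johnstone's dcpo $\mathcal{S}$ has underlying set $\mathbb{N}\times\overline{\mathbb{N}}$ with strict order $<\;=\;<_1\cup<_2\cup<_3$, where for $m,m',n,n'\in\mathbb{N}$: $(m,n)<_1(m,n')$ if $n<n'$; $(m,n)<_2(m,\infty)$; $(m,n)<_3(m',\infty)$ if $n\le m'$; and $\le\;=\;<\cup=$. For a dcpo $D$: a subset is irreducible if nonempty and whenever contained in a union of two Scott-closed sets it is contained in one of them; $\mathsf{Irr}(D)$ is the set of Scott-closed irreducible subsets ordered by inclusion; for $A',A\in\mathsf{Irr}(D)$, $A'\triangleleft A$ iff $A'\subseteq{\downarrow}x$ for some $x\in A$; $\nabla A=\{A'\in\mathsf{Irr}(D)\mid A'\triangleleft A\}$; $D$ is dominated if $\nabla A$ is Scott-closed in $\mathsf{Irr}(D)$ for every $A\in\mathsf{Irr}(D)$. -}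

module Defs where

open import Level using (Level; _⊔_; 0ℓ) renaming (suc to lsuc)
open import Data.Nat using (ℕ; _<_; _≤_)
open import Data.Product using (Σ; ∃; ∃-syntax; _×_; _,_)
open import Data.Sum using (_⊎_)
open import Relation.Binary.PropositionalEquality using (_≡_)
open import Relation.Unary using (Pred; _∈_; _⊆_; _∪_)

module Order {a r : Level} (X : Set a) (_⊑_ : X → X → Set r) where

  IsLower : ∀ {s} → Pred X s → Set (a ⊔ r ⊔ s)
  IsLower C = ∀ {x y} → x ∈ C → y ⊑ x → y ∈ C

  Directed : ∀ {s} → Pred X s → Set (a ⊔ r ⊔ s)
  Directed D = (∃[ x ] x ∈ D)
             × (∀ {x y} → x ∈ D → y ∈ D → ∃[ z ] (z ∈ D × x ⊑ z × y ⊑ z))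

  IsUpperBound : ∀ {s} → Pred X s → X → Set (a ⊔ r ⊔ s)
  IsUpperBound D u = ∀ {x} → x ∈ D → x ⊑ u

  IsSup : ∀ {s} → Pred X s → X → Set (a ⊔ r ⊔ s)
  IsSup D u = IsUpperBound D u × (∀ v → IsUpperBound D v → u ⊑ v)

  ScottClosed : ∀ {s} → Pred X s → Set (a ⊔ r ⊔ lsuc s)
  ScottClosed {s} C = IsLower C
                    × (∀ (D : Pred X s) → Directed D → D ⊆ C → ∀ u → IsSup D u → u ∈ C)

  Irreducible : ∀ {s} → Pred X s → Set (a ⊔ r ⊔ lsuc s)
  Irreducible {s} A = (∃[ x ] x ∈ A)
                    × (∀ (C₁ C₂ : Pred X s) → ScottClosed C₁ → ScottClosed C₂
                         → A ⊆ (C₁ ∪ C₂) → (A ⊆ C₁) ⊎ (A ⊆ C₂))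

module IrrDefs {a r : Level} (X : Set a) (_⊑_ : X → X → Set r) where

  open Order X _⊑_

  ↓_ : X → Pred X r
  ↓ x = λ y → y ⊑ x

  Irr : Set (a ⊔ r ⊔ lsuc 0ℓ)
  Irr = Σ (Pred X 0ℓ) (λ A → ScottClosed A × Irreducible A)

  carrier : Irr → Pred X 0ℓ
  carrier (A , _) = A

  _⊆Irr_ : Irr → Irr → Set a
  A′ ⊆Irr A = carrier A′ ⊆ carrier A

  _◁_ : Irr → Irr → Set (a ⊔ r)
  A′ ◁ A = ∃[ x ] (x ∈ carrier A × carrier A′ ⊆ (↓ x))

  ∇ : Irr → Pred Irr (a ⊔ r)
  ∇ A = λ A′ → A′ ◁ A

  Dominated : Set (lsuc (a ⊔ r))
  Dominated = ∀ (A : Irr) → Order.ScottClosed Irr _⊆Irr_ (∇ A)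

data ℕ̄ : Set where
  fin : ℕ → ℕ̄
  ∞   : ℕ̄

JElt : Set
JElt = ℕ × ℕ̄

data _<J_ : JElt → JElt → Set where
  <₁ : ∀ {m n n′} → n < n′ → (m , fin n) <J (m , fin n′)
  <₂ : ∀ {m n} → (m , fin n) <J (m , ∞)
  <₃ : ∀ {m m′ n} → n ≤ m′ → (m , fin n) <J (m′ , ∞)

_≤J_ : JElt → JElt → Set
x ≤J y = x <J y ⊎ x ≡ y

JohnstoneDominated : Set₁
JohnstoneDominated = IrrDefs.Dominated JElt _≤J_

module Submission where

-- A directed subset of 𝒮 either contains a point (j , ∞), which is then its
-- greatest element, or lies in a single column k; inside a Scott-closed set A
-- it is then bounded by its maximum if A meets column k in a finite segment,
-- and by (k , ∞) ∈ A otherwise. An irreducible closed set B ⊆ ↓x is principal: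
-- if x ∉ B then B has no point (j , ∞), so every B ∖ ↑a is Scott-closed, and
-- two points of B without a common upper bound in B would split B into
-- B ∖ ↑a ∪ B ∖ ↑b; hence B is directed and bounded in itself. For a directed
-- D ⊆ ∇A this makes ⋃D directed, so it has an upper bound x ∈ A; then ↓x is an
-- upper bound of D in Irr and contains its supremum.

open import Defs
open import Level using (0ℓ; Lift; lift; lower) renaming (suc to lsuc)
open import Axiom.ExcludedMiddle using (ExcludedMiddle)
open import Data.Nat using (ℕ; zero; suc; _⊔_; _<_; _≤_; s≤s; s≤s⁻¹)
open import Data.Nat.Properties
  using (≤-refl; ≤-trans; <-trans; <⇒≤; <-asym; <-irrefl; n≮0; ≰⇒>; ≤∧≢⇒<; m≤n⇒m<n∨m≡n; m≤m⊔n; m≤n⊔m)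
open import Data.Product using (∃-syntax; _×_; _,_; proj₁; proj₂)
open import Data.Sum using (_⊎_; inj₁; inj₂)
open import Data.Empty using (⊥-elim)
open import Function using (id)
open import Relation.Nullary using (¬_; yes; no)
open import Relation.Nullary.Decidable using (map′; decidable-stable)
open import Relation.Binary.PropositionalEquality using (_≡_; refl; subst)
open import Relation.Unary using (Pred; _∈_; _∉_; _⊆_; _∪_)

open Order JElt _≤J_
open IrrDefs JElt _≤J_
module IrrOrder = Order Irr _⊆Irr_

lower-em : ∀ {ℓ} ℓ′ → ExcludedMiddle (ℓ Level.⊔ ℓ′) → ExcludedMiddle ℓ
lower-em ℓ′ em {P} = map′ lower lift (em {Lift ℓ′ P})

bounded-max : ∀ {ℓ} → ExcludedMiddle ℓ → (P : Pred ℕ ℓ) → ∀ N → (∀ {n} → P n → n < N)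
            → ∀ {n₀} → P n₀ → ∃[ m ] (P m × (∀ {n} → P n → n ≤ m))
bounded-max em P zero    bound p₀ = ⊥-elim (n≮0 (bound p₀))
bounded-max em P (suc N) bound p₀ with em {P N}
... | yes pN = N , pN , λ pn → s≤s⁻¹ (bound pn)
... | no ¬pN = bounded-max em P N (λ pn → ≤∧≢⇒< (s≤s⁻¹ (bound pn)) λ { refl → ¬pN pn }) p₀

≤J-refl : ∀ {x} → x ≤J x
≤J-refl = inj₂ refl

≤J-trans : ∀ {x y z} → x ≤J y → y ≤J z → x ≤J z
≤J-trans (inj₂ refl)   q                = q
≤J-trans (inj₁ p)      (inj₂ refl)      = inj₁ p
≤J-trans (inj₁ (<₁ p)) (inj₁ (<₁ q))    = inj₁ (<₁ (<-trans p q))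
≤J-trans (inj₁ (<₁ p)) (inj₁ <₂)        = inj₁ <₂
≤J-trans (inj₁ (<₁ p)) (inj₁ (<₃ q))    = inj₁ (<₃ (≤-trans (<⇒≤ p) q))
≤J-trans (inj₁ <₂)     (inj₁ ())
≤J-trans (inj₁ (<₃ _)) (inj₁ ())

≤J-antisym : ∀ {x y} → x ≤J y → y ≤J x → x ≡ y
≤J-antisym (inj₂ refl)   _                = refl
≤J-antisym (inj₁ _)      (inj₂ refl)      = refl
≤J-antisym (inj₁ (<₁ p)) (inj₁ (<₁ q))    = ⊥-elim (<-asym p q)
≤J-antisym (inj₁ <₂)     (inj₁ ())
≤J-antisym (inj₁ (<₃ _)) (inj₁ ())

∞-maximal : ∀ {j z} → (j , ∞) ≤J z → z ≡ (j , ∞)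
∞-maximal (inj₁ ())
∞-maximal (inj₂ refl) = refl

fin-mono : ∀ {k a b} → a ≤ b → (k , fin a) ≤J (k , fin b)
fin-mono a≤b with m≤n⇒m<n∨m≡n a≤b
... | inj₁ a<b  = inj₁ (<₁ a<b)
... | inj₂ refl = ≤J-refl

below-fin : ∀ {z k n} → z ≤J (k , fin n) → ∃[ i ] (z ≡ (k , fin i) × i ≤ n)
below-fin (inj₁ (<₁ p)) = _ , refl , <⇒≤ p
below-fin (inj₂ refl)   = _ , refl , ≤-refl

Column : ℕ → Pred JElt 0ℓ
Column k z = ∃[ i ] (z ≡ (k , fin i))

Column⊆↓∞ : ∀ {k} → Column k ⊆ ↓ (k , ∞)
Column⊆↓∞ (_ , refl) = inj₁ <₂

Column-directed : ∀ {k} → Directed (Column k)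
Column-directed {k} = ((k , fin 0) , 0 , refl) , upper
  where
  upper : ∀ {x y} → x ∈ Column k → y ∈ Column k → ∃[ z ] (z ∈ Column k × x ≤J z × y ≤J z)
  upper (m , refl) (n , refl) =
    (k , fin (m ⊔ n)) , (m ⊔ n , refl) , fin-mono (m≤m⊔n m n) , fin-mono (m≤n⊔m m n)

Column-sup : ∀ {k} → IsSup (Column k) (k , ∞)
Column-sup {k} = Column⊆↓∞ , least
  where
  least : ∀ v → IsUpperBound (Column k) v → (k , ∞) ≤J v
  least (_ , fin b) ub with below-fin (ub (suc b , refl))
  ... | _ , refl , b+1≤b = ⊥-elim (<-irrefl refl b+1≤b)
  least (j , ∞) ub with ub (suc j , refl)
  ... | inj₁ <₂     = ≤J-refl
  ... | inj₁ (<₃ p) = ⊥-elim (<-irrefl refl p)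

Irr-ScottClosed : (B : Irr) → ScottClosed (carrier B)
Irr-ScottClosed (_ , closed , _) = closed

↓-Irr : JElt → Irr
↓-Irr x = ↓ x , (lower-closed , sup-closed) , (x , ≤J-refl) , irreducible
  where
  lower-closed : IsLower (↓ x)
  lower-closed y≤x z≤y = ≤J-trans z≤y y≤x

  sup-closed : ∀ (D : Pred JElt 0ℓ) → Directed D → D ⊆ ↓ x → ∀ u → IsSup D u → u ≤J x
  sup-closed D _ D⊆↓x u (_ , least) = least x D⊆↓x

  irreducible : ∀ (C₁ C₂ : Pred JElt 0ℓ) → ScottClosed C₁ → ScottClosed C₂
              → ↓ x ⊆ C₁ ∪ C₂ → (↓ x ⊆ C₁) ⊎ (↓ x ⊆ C₂)
  irreducible C₁ C₂ (lower₁ , _) (lower₂ , _) cover with cover ≤J-refl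
  ... | inj₁ x∈C₁ = inj₁ (lower₁ x∈C₁)
  ... | inj₂ x∈C₂ = inj₂ (lower₂ x∈C₂)

module _ {ℓ} {E : Pred JElt ℓ} (directed : Directed E) where

  directed-∞-greatest : ∀ {j} → (j , ∞) ∈ E → E ⊆ ↓ (j , ∞)
  directed-∞-greatest j∈E z∈E with proj₂ directed j∈E z∈E
  ... | c , _ , j≤c , z≤c with ∞-maximal j≤c
  ... | refl = z≤c

  directed-in-Column : (∀ {j} → (j , ∞) ∉ E) → ∃[ k ] (E ⊆ Column k)
  directed-in-Column no∞ with proj₁ directed
  ... | (_ , ∞)     , e∈E = ⊥-elim (no∞ e∈E)
  ... | (k , fin _) , e∈E = k , in-Column
    where
    in-Column : E ⊆ Column k
    in-Column z∈E with proj₂ directed e∈E z∈E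
    ... | (_ , ∞) , c∈E , _ = ⊥-elim (no∞ c∈E)
    ... | (_ , fin _) , _ , e≤c , z≤c with below-fin e≤c | below-fin z≤c
    ... | _ , refl , _ | i , z≡ , _ = i , z≡

module _ {ℓ} (em : ExcludedMiddle ℓ) where

  Column-max : ∀ {k} (W : Pred JElt ℓ) → W ⊆ Column k → ∀ N → (∀ {i} → (k , fin i) ∈ W → i < N)
             → ∃[ w ] (w ∈ W) → ∃[ m ] ((k , fin m) ∈ W × W ⊆ ↓ (k , fin m))
  Column-max {k} W W⊆Column N bound (w , w∈W) with W⊆Column w∈W
  ... | _ , refl with bounded-max em (λ i → (k , fin i) ∈ W) N bound w∈W
  ... | m , m∈W , maximal = m , m∈W , W⊆↓m
    where
    W⊆↓m : W ⊆ ↓ (k , fin m)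
    W⊆↓m z∈W with W⊆Column z∈W
    ... | _ , refl = fin-mono (maximal z∈W)

  finite-sup-attained : ∀ {k n} (D : Pred JElt ℓ) → ∃[ d ] (d ∈ D) → IsSup D (k , fin n)
                      → (k , fin n) ∈ D
  finite-sup-attained {k} {n} D nonempty (ub , least) =
    let m , m∈D , D⊆↓m = Column-max D D⊆Column (suc n) bound nonempty
    in  subst (_∈ D) (≤J-antisym (ub m∈D) (least _ D⊆↓m)) m∈D
    where
    D⊆Column : D ⊆ Column k
    D⊆Column d∈D with below-fin (ub d∈D)
    ... | i , d≡ , _ = i , d≡

    bound : ∀ {i} → (k , fin i) ∈ D → i < suc n
    bound i∈D with below-fin (ub i∈D)
    ... | _ , refl , i≤n = s≤s i≤n

  Column-bounded-in : ∀ {k} (A : Pred JElt 0ℓ) → ScottClosed A → (W : Pred JElt ℓ) → W ⊆ A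
                    → W ⊆ Column k → ∃[ w ] (w ∈ W) → ∃[ x ] (x ∈ A × W ⊆ ↓ x)
  Column-bounded-in {k} A (lowerA , supA) W W⊆A W⊆Column nonempty
    with lower-em ℓ em {∃[ N ] ((k , fin N) ∉ A)}
  ... | yes (N , N∉A) =
    let m , m∈W , W⊆↓m = Column-max W W⊆Column N bound nonempty
    in  (k , fin m) , W⊆A m∈W , W⊆↓m
    where
    bound : ∀ {i} → (k , fin i) ∈ W → i < N
    bound i∈W = ≰⇒> (λ N≤i → N∉A (lowerA (W⊆A i∈W) (fin-mono N≤i)))
  ... | no ∄N∉A =
    (k , ∞) , supA (Column k) Column-directed Column⊆A (k , ∞) Column-sup
            , λ z∈W → Column⊆↓∞ (W⊆Column z∈W)
    where
    Column⊆A : Column k ⊆ A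
    Column⊆A (n , refl) = decidable-stable (lower-em ℓ em) (λ n∉A → ∄N∉A (n , n∉A))

  directed-bounded-in : (A : Pred JElt 0ℓ) → ScottClosed A → (E : Pred JElt ℓ) → Directed E → E ⊆ A
                      → ∃[ x ] (x ∈ A × E ⊆ ↓ x)
  directed-bounded-in A closedA E directed E⊆A with em {∃[ j ] ((j , ∞) ∈ E)}
  ... | yes (j , j∈E) = (j , ∞) , E⊆A j∈E , directed-∞-greatest directed j∈E
  ... | no ∄∞ with directed-in-Column directed (λ j∈E → ∄∞ (_ , j∈E))
  ... | k , E⊆Column = Column-bounded-in A closedA E E⊆A E⊆Column (proj₁ directed)

_∖↑_ : Pred JElt 0ℓ → JElt → Pred JElt 0ℓ
(B ∖↑ a) z = z ∈ B × ¬ (a ≤J z)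

module _ (em : ExcludedMiddle 0ℓ) where

  ∖↑-ScottClosed : ∀ {B a} → ScottClosed B → (∀ {j} → (j , ∞) ∉ B) → ScottClosed (B ∖↑ a)
  ∖↑-ScottClosed {B} {a} (lowerB , supB) no∞ = lower-closed , sup-closed
    where
    lower-closed : IsLower (B ∖↑ a)
    lower-closed (z∈B , a≰z) w≤z = lowerB z∈B w≤z , λ a≤w → a≰z (≤J-trans a≤w w≤z)

    sup-closed : ∀ (D : Pred JElt 0ℓ) → Directed D → D ⊆ B ∖↑ a → ∀ u → IsSup D u → u ∈ B ∖↑ a
    sup-closed D directed D⊆ (_ , ∞)     sup =
      ⊥-elim (no∞ (supB D directed (λ d∈D → proj₁ (D⊆ d∈D)) _ sup))
    sup-closed D directed D⊆ (_ , fin _) sup = D⊆ (finite-sup-attained em D (proj₁ directed) sup)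

  ∖↑-cover : ∀ {B a b} → ¬ (∃[ c ] (c ∈ B × a ≤J c × b ≤J c)) → B ⊆ (B ∖↑ a) ∪ (B ∖↑ b)
  ∖↑-cover {a = a} {b} no-upper {z} z∈B with em {a ≤J z} | em {b ≤J z}
  ... | no a≰z  | _        = inj₁ (z∈B , a≰z)
  ... | yes _   | no b≰z   = inj₂ (z∈B , b≰z)
  ... | yes a≤z | yes b≤z  = ⊥-elim (no-upper (z , z∈B , a≤z , b≤z))

  irreducible-directed : (B : Irr) → (∀ {j} → (j , ∞) ∉ carrier B) → Directed (carrier B)
  irreducible-directed (B , closedB , nonempty , irreducible) no∞ = nonempty , upper
    where
    upper : ∀ {a b} → a ∈ B → b ∈ B → ∃[ c ] (c ∈ B × a ≤J c × b ≤J c)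
    upper {a} {b} a∈B b∈B with em {∃[ c ] (c ∈ B × a ≤J c × b ≤J c)}
    ... | yes c = c
    ... | no no-upper
      with irreducible (B ∖↑ a) (B ∖↑ b) (∖↑-ScottClosed closedB no∞) (∖↑-ScottClosed closedB no∞)
                       (∖↑-cover no-upper)
    ... | inj₁ B⊆B∖↑a = ⊥-elim (proj₂ (B⊆B∖↑a a∈B) ≤J-refl)
    ... | inj₂ B⊆B∖↑b = ⊥-elim (proj₂ (B⊆B∖↑b b∈B) ≤J-refl)

  bounded-Irr-principal : ∀ {x} (B : Irr) → carrier B ⊆ ↓ x
                        → ∃[ y ] (y ∈ carrier B × carrier B ⊆ ↓ y)
  bounded-Irr-principal {x} B B⊆↓x with em {x ∈ carrier B}
  ... | yes x∈B = x , x∈B , B⊆↓x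
  ... | no x∉B  = directed-bounded-in em (carrier B) (Irr-ScottClosed B) (carrier B)
                    (irreducible-directed B no∞) id
    where
    no∞ : ∀ {j} → (j , ∞) ∉ carrier B
    no∞ j∈B with ∞-maximal (B⊆↓x j∈B)
    ... | refl = x∉B j∈B

⋃ : Pred Irr 0ℓ → Pred JElt (lsuc 0ℓ)
⋃ D z = ∃[ d ] (d ∈ D × z ∈ carrier d)

module _ (em : ExcludedMiddle (lsuc 0ℓ)) (A : Irr) {D : Pred Irr 0ℓ} (D⊆∇A : D ⊆ ∇ A) where

  ⋃-directed : IrrOrder.Directed D → Directed (⋃ D)
  ⋃-directed (((d₀ , _ , (w₀ , w₀∈d₀) , _) , d₀∈D) , upperD) = (w₀ , _ , d₀∈D , w₀∈d₀) , upper
    where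
    upper : ∀ {w₁ w₂} → w₁ ∈ ⋃ D → w₂ ∈ ⋃ D → ∃[ y ] (y ∈ ⋃ D × w₁ ≤J y × w₂ ≤J y)
    upper (_ , d₁∈D , w₁∈d₁) (_ , d₂∈D , w₂∈d₂) with upperD d₁∈D d₂∈D
    ... | d , d∈D , d₁⊆d , d₂⊆d with D⊆∇A d∈D
    ... | _ , _ , d⊆↓x with bounded-Irr-principal (lower-em (lsuc 0ℓ) em) d d⊆↓x
    ... | y , y∈d , d⊆↓y = y , (d , d∈D , y∈d) , d⊆↓y (d₁⊆d w₁∈d₁) , d⊆↓y (d₂⊆d w₂∈d₂)

  ⋃⊆ : ⋃ D ⊆ carrier A
  ⋃⊆ (_ , d∈D , z∈d) with D⊆∇A d∈D
  ... | _ , x∈A , d⊆↓x = proj₁ (Irr-ScottClosed A) x∈A (d⊆↓x z∈d)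

proposition3p2 : ExcludedMiddle (lsuc 0ℓ) → IrrDefs.Dominated JElt _≤J_
proposition3p2 em A .proj₁ (x , x∈A , A′⊆↓x) A″⊆A′ = x , x∈A , λ z∈A″ → A′⊆↓x (A″⊆A′ z∈A″)
proposition3p2 em A .proj₂ D directed D⊆∇A U (_ , least)
  with directed-bounded-in em (carrier A) (Irr-ScottClosed A) (⋃ D)
         (⋃-directed em A D⊆∇A directed) (⋃⊆ em A D⊆∇A)
... | x , x∈A , ⋃D⊆↓x = x , x∈A , least (↓-Irr x) (λ d∈D z∈d → ⋃D⊆↓x (_ , d∈D , z∈d))
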